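{- Let $A$ be a non-empty finite alphabet with $r = |A|$ letters. (a) If $C$ and $D$ are uniquely decipherable codes over $A$ with $C \leq D$ (i.e. $D$ is finer than $C$), then $K(C) \leq K(D)$. (b) For each uniquely decipherable code $C$ over $A$ there are only finitely many uniquely decipherable codes $D$ over $A$ with $C \leq D$ and $K(D) = K(C)$.
   Context: $A^{\ast}$ denotes the set of finite strings (words) over $A$, and $A^{\ast\ast}$ the set of finite strings of words; $con: A^{\ast\ast}\to A^{\ast}$ is the concatenation map sending a string of words to their concatenation. A code is a finite subset $C \subseteq A^{\ast}$ not containing the empty string. For a code $C$, $C^{\ast}\subseteq A^{\ast\ast}$ is the set of all finite strings of words from $C$. A code $C$ is uniquely decipherable (UD) if $con$ is injective on $C^{\ast}$. For codes $C, D$, write $C \leq D$ (and say $D$ is finer than $C$, or a refinement of $C$) if $C \subseteq con[D^{\ast}]$, i.e. every word of $C$ is a concatenation of words of $D$. The Kraft sum of a code $C$ is $K(C) = \sum_{\mathbf{x}\in C} r^{ -len(\mathbf{x})}$, where $len$ is word length. -}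

module Defs where

open import Data.Nat using (ℕ; NonZero; _^_)
open import Data.Nat.Properties using (m^n≢0)
open import Data.Integer using (+_)
open import Data.Rational using (ℚ; _/_; _+_; 0ℚ)
open import Data.List using (List; []; length; concat)
open import Data.List.Membership.Propositional using (_∈_; _∉_)
open import Data.List.Relation.Unary.All using (All)
open import Data.List.Relation.Unary.Unique.Propositional using (Unique)
open import Data.Product using (Σ; _×_)
open import Relation.Binary.PropositionalEquality using (_≡_)

-- Words over A are lists of letters: A* = List A.
-- A code is a finite set of non-empty words, represented as a
-- duplicate-free list (so that the Kraft sum counts each word once).
IsCode : {A : Set} → List (List A) → Set
IsCode C = ([] ∉ C) × Unique C

InStar : {A : Set} → List (List A) → List (List A) → Set
InStar C ws = All (_∈ C) ws

UD : {A : Set} → List (List A) → Set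
UD C = ∀ xs ys → InStar C xs → InStar C ys → concat xs ≡ concat ys → xs ≡ ys

_≼_ : {A : Set} → List (List A) → List (List A) → Set
C ≼ D = ∀ x → x ∈ C → Σ (List (List _)) λ ws → InStar D ws × (concat ws ≡ x)

Kraft : {A : Set} (r : ℕ) .{{_ : NonZero r}} → List (List A) → ℚ
Kraft r [] = 0ℚ
Kraft r (x Data.List.∷ C) = ((+ 1) / (r ^ length x)) {{m^n≢0 r (length x)}} + Kraft r C

SameSet : {A : Set} → List (List A) → List (List A) → Set
SameSet {A} C D = ∀ (x : List A) → (x ∈ C → x ∈ D) × (x ∈ D → x ∈ C)

-- If C ≤ D, decomposing every word of C into words of D maps the strings in C^k
-- injectively (C is UD) to strings of D-words of length between k and kL, where L
-- bounds the lengths of the words of C, and preserves their concatenations.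
-- Summing r^(-length) gives K(C)^k ≤ (kL + 1) K(D)^k once K(D) ≤ 1, and taking
-- k-th roots K(C) ≤ K(D). The hypothesis K(D) ≤ 1 is McMillan's inequality, the
-- case C := D, D := alphabet of the same argument.
-- For (b): if K(D) = K(C), every word of D occurs in the decomposition of some word
-- of C, since dropping an unused word keeps a refinement of C but lowers K(D). So D
-- consists of words of length at most L, and is one of finitely many sets.

module Submission where

open import Algebra.Bundles using (CommutativeRing)
open import Data.Empty using (⊥-elim)
open import Data.Fin using (Fin)
import Data.Fin.Properties as Fin
open import Data.Integer as ℤ using ()
import Data.Integer.Properties as ℤ
open import Data.List
  using (List; []; _∷_; [_]; _++_; map; concat; concatMap; cartesianProductWith; length; filter; allFin)
open import Data.List.Membership.Propositional using (_∈_; _∉_)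
open import Data.List.Membership.Propositional.Properties
  using ( ∈-∃++; ∈-++⁻; ∈-++⁺ˡ; ∈-++⁺ʳ; ∈-map⁺; ∈-map⁻; ∈-concat⁺′; ∈-concat⁻′; ∈-allFin
        ; ∈-filter⁺; ∈-filter⁻; ∈-cartesianProductWith⁺; ∈-cartesianProductWith⁻)
import Data.List.Properties as List
open import Data.List.Relation.Binary.Subset.Propositional using (_⊆_)
open import Data.List.Relation.Unary.All as All using (All; []; _∷_)
import Data.List.Relation.Unary.All.Properties as All
open import Data.List.Relation.Unary.AllPairs using ([]; _∷_)
open import Data.List.Relation.Unary.Any using (here; there)
open import Data.List.Relation.Unary.Unique.Propositional using (Unique)
import Data.List.Relation.Unary.Unique.Propositional.Properties as Unique
open import Data.Nat as ℕ using (ℕ; zero; suc; NonZero)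
import Data.Nat.Coprimality as ℕ
import Data.Nat.Properties as ℕ
open import Data.List.Extrema ℕ.≤-totalOrder using (max; xs≤max)
open import Data.Nat.Solver renaming (module +-*-Solver to ℕ-Solver)
open import Data.Product using (Σ; ∃-syntax; _×_; _,_; proj₁; proj₂)
open import Data.Rational as ℚ
  using (ℚ; mkℚ; _/_; 0ℚ; 1ℚ; _+_; _*_; _-_; 1/_; _≤_; _<_; toℚᵘ; Positive; positive; nonNegative)
import Data.Rational.Properties as ℚ
open import Data.Rational.Solver renaming (module +-*-Solver to ℚ-Solver)
import Data.Rational.Unnormalised as ℚᵘ
import Data.Rational.Unnormalised.Properties as ℚᵘ
open import Data.Sum using (inj₁; inj₂)
open import Function using (_∘_; _↔_; Inverse)
open import Function.Properties.Inverse using (↔-sym; ↔⇒↣)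
open import Relation.Binary.Definitions using (DecidableEquality; tri<; tri≈; tri>)
open import Relation.Binary.PropositionalEquality
  using (_≡_; refl; sym; trans; cong; cong₂; subst; subst₂; module ≡-Reasoning)
open import Relation.Nullary using (yes; no)
open import Relation.Unary using (Decidable)

open import Defs

open CommutativeRing ℚ.+-*-commutativeRing using (commutativeSemiring; semiring)
open import Algebra.Properties.CommutativeSemiring.Exp commutativeSemiring using (_^_; ^-homo-*; ^-distrib-*)
import Algebra.Properties.Semiring.Mult semiring as Mult

-- Rationals

0≤1 : 0ℚ ≤ 1ℚ
0≤1 = ℚ.<⇒≤ (ℚ.positive⁻¹ 1ℚ)

p≤q+p : ∀ {p q} → 0ℚ ≤ q → p ≤ q + p
p≤q+p {p} {q} 0≤q = subst (_≤ q + p) (ℚ.+-identityˡ p) (ℚ.+-monoˡ-≤ p 0≤q)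

*-nonNeg : ∀ {p q} → 0ℚ ≤ p → 0ℚ ≤ q → 0ℚ ≤ p * q
*-nonNeg {p} {q} 0≤p 0≤q =
  ℚ.nonNegative⁻¹ _ {{ℚ.nonNeg*nonNeg⇒nonNeg p {{nonNegative 0≤p}} q {{nonNegative 0≤q}}}}

*-mono-≤-nonNeg : ∀ {p q r s} → 0ℚ ≤ p → 0ℚ ≤ r → p ≤ q → r ≤ s → p * r ≤ q * s
*-mono-≤-nonNeg {p} {q} {r} {s} 0≤p 0≤r p≤q r≤s =
  ℚ.≤-trans (ℚ.*-monoˡ-≤-nonNeg p {{nonNegative 0≤p}} r≤s)
            (ℚ.*-monoʳ-≤-nonNeg s {{nonNegative (ℚ.≤-trans 0≤r r≤s)}} p≤q)

^-nonNeg : ∀ {p} → 0ℚ ≤ p → ∀ k → 0ℚ ≤ p ^ k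
^-nonNeg 0≤p zero    = 0≤1
^-nonNeg 0≤p (suc k) = *-nonNeg 0≤p (^-nonNeg 0≤p k)

^-pos : ∀ {p} → 0ℚ < p → ∀ k → Positive (p ^ k)
^-pos 0<p zero    = _
^-pos {p} 0<p (suc k) = ℚ.pos*pos⇒pos p {{positive 0<p}} (p ^ k) {{^-pos 0<p k}}

^-suc-≤ : ∀ {q} → 0ℚ ≤ q → q ≤ 1ℚ → ∀ k → q ^ suc k ≤ q ^ k
^-suc-≤ {q} 0≤q q≤1 k = ℚ.≤-trans (ℚ.*-monoʳ-≤-nonNeg (q ^ k) {{nonNegative (^-nonNeg 0≤q k)}} q≤1)
                                   (ℚ.≤-reflexive (ℚ.*-identityˡ (q ^ k)))

fromℕ : ℕ → ℚ
fromℕ n = n Mult.× 1ℚ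

fromℕ-nonNeg : ∀ n → 0ℚ ≤ fromℕ n
fromℕ-nonNeg zero    = ℚ.≤-refl
fromℕ-nonNeg (suc n) = ℚ.+-mono-≤ 0≤1 (fromℕ-nonNeg n)

fromℕ-* : ∀ m n → fromℕ (m ℕ.* n) ≡ fromℕ m * fromℕ n
fromℕ-* = Mult.×1-homo-*

fromℕ≡mkℚ : ∀ n → fromℕ n ≡ mkℚ (ℤ.+ n) 0 (ℕ.sym (ℕ.1-coprimeTo n))
fromℕ≡mkℚ zero    = refl
fromℕ≡mkℚ (suc n) = begin
  1ℚ + fromℕ n
    ≡⟨ cong (1ℚ +_) (fromℕ≡mkℚ n) ⟩
  1ℚ + mkℚ (ℤ.+ n) 0 (ℕ.sym (ℕ.1-coprimeTo n))
    ≡⟨ cong (λ z → (ℤ.+ 1 ℤ.+ z) / 1) (ℤ.*-identityʳ (ℤ.+ n)) ⟩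
  ℤ.+ suc n / 1
    ≡⟨ ℚ.normalize-coprime _ ⟩
  mkℚ (ℤ.+ suc n) 0 _ ∎
  where open ≡-Reasoning

fromℕ-mono-< : ∀ {m n} → m ℕ.< n → fromℕ m < fromℕ n
fromℕ-mono-< {m} {n} m<n rewrite fromℕ≡mkℚ m | fromℕ≡mkℚ n =
  ℚ.*<* (subst₂ ℤ._<_ (sym (ℤ.*-identityʳ (ℤ.+ m))) (sym (ℤ.*-identityʳ (ℤ.+ n))) (ℤ.+<+ m<n))

archimedean : ∀ δ .{{_ : Positive δ}} → ∃[ n ] 1ℚ ≤ fromℕ n * δ
archimedean δ@(mkℚ (ℤ.+ suc a) d _) =
  suc d , ℚ.toℚᵘ-cancel-≤ (ℚᵘ.≤-respʳ-≃ (ℚᵘ.≃-sym toℚᵘ[nδ]) (ℚᵘ.*≤* cross-multiplied))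
  where
  toℚᵘ[nδ] : toℚᵘ (fromℕ (suc d) * δ) ℚᵘ.≃
             ℚᵘ.mkℚᵘ (ℤ.+ suc d) 0 ℚᵘ.* ℚᵘ.mkℚᵘ (ℤ.+ suc a) d
  toℚᵘ[nδ] = ℚᵘ.≃-trans (ℚ.toℚᵘ-homo-* (fromℕ (suc d)) δ)
               (ℚᵘ.*-congʳ (ℚᵘ.≃-reflexive (cong toℚᵘ (fromℕ≡mkℚ (suc d)))))
  cross-multiplied : ℤ.+ 1 ℤ.* ℤ.+ suc (d ℕ.+ 0) ℤ.≤ ℤ.+ (suc d ℕ.* suc a) ℤ.* ℤ.+ 1
  cross-multiplied = subst₂ ℤ._≤_ (sym (ℤ.*-identityˡ _)) (sym (ℤ.*-identityʳ _)) (ℤ.+≤+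
    (subst (ℕ._≤ suc d ℕ.* suc a) (cong suc (sym (ℕ.+-identityʳ d))) (ℕ.m≤m*n (suc d) (suc a))))

bernoulli : ∀ {δ} → 0ℚ ≤ δ → ∀ m → 1ℚ + fromℕ m * δ ≤ (1ℚ + δ) ^ m
bernoulli {δ} 0≤δ zero = ℚ.≤-reflexive (trans (cong (1ℚ +_) (ℚ.*-zeroˡ δ)) (ℚ.+-identityʳ 1ℚ))
bernoulli {δ} 0≤δ (suc m) = begin
  1ℚ + fromℕ (suc m) * δ
    ≤⟨ p≤q+p (*-nonNeg (*-nonNeg (fromℕ-nonNeg m) 0≤δ) 0≤δ) ⟩
  fromℕ m * δ * δ + (1ℚ + (1ℚ + fromℕ m) * δ)
    ≡⟨ solve 2 (λ d x → x :* d :* d :+ (con 1ℚ :+ (con 1ℚ :+ x) :* d)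
                        := (con 1ℚ :+ d) :* (con 1ℚ :+ x :* d)) refl δ (fromℕ m) ⟩
  (1ℚ + δ) * (1ℚ + fromℕ m * δ)
    ≤⟨ ℚ.*-monoˡ-≤-nonNeg (1ℚ + δ) {{nonNegative (ℚ.+-mono-≤ 0≤1 0≤δ)}} (bernoulli 0≤δ m) ⟩
  (1ℚ + δ) * (1ℚ + δ) ^ m ∎
  where open ℚ.≤-Reasoning; open ℚ-Solver

^-dominates-linear : ∀ {t} → 1ℚ < t → ∃[ n ] ∀ c → fromℕ c ≤ t ^ (n ℕ.* c)
^-dominates-linear {t} 1<t = n , λ c → begin
  fromℕ c                     ≡⟨ sym (ℚ.*-identityʳ _) ⟩
  fromℕ c * 1ℚ                ≤⟨ ℚ.*-monoˡ-≤-nonNeg (fromℕ c) {{nonNegative (fromℕ-nonNeg c)}} 1≤nδ ⟩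
  fromℕ c * (fromℕ n * δ)     ≡⟨ solve 3 (λ c n d → c :* (n :* d) := (n :* c) :* d)
                                        refl (fromℕ c) (fromℕ n) δ ⟩
  fromℕ n * fromℕ c * δ       ≡⟨ cong (_* δ) (sym (fromℕ-* n c)) ⟩
  fromℕ (n ℕ.* c) * δ         ≤⟨ p≤q+p 0≤1 ⟩
  1ℚ + fromℕ (n ℕ.* c) * δ    ≤⟨ bernoulli (ℚ.<⇒≤ 0<δ) (n ℕ.* c) ⟩
  (1ℚ + δ) ^ (n ℕ.* c)        ≡⟨ cong (_^ (n ℕ.* c)) 1+δ≡t ⟩
  t ^ (n ℕ.* c)               ∎
  where
  open ℚ.≤-Reasoning
  open ℚ-Solver
  δ = t - 1ℚ
  0<δ : 0ℚ < δ
  0<δ = subst (_< δ) (ℚ.+-inverseʳ 1ℚ) (ℚ.+-monoˡ-< (ℚ.- 1ℚ) 1<t)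
  1+δ≡t : 1ℚ + δ ≡ t
  1+δ≡t = solve 1 (λ t → con 1ℚ :+ (t :- con 1ℚ) := t) refl t
  instance _ = positive 0<δ
  n = proj₁ (archimedean δ)
  1≤nδ = proj₂ (archimedean δ)

^-bounded-by-linear⇒≤1 : ∀ {t} L → (∀ k → t ^ k ≤ fromℕ (suc (k ℕ.* L))) → t ≤ 1ℚ
^-bounded-by-linear⇒≤1 {t} L bound with t ℚ.≤? 1ℚ
... | yes t≤1 = t≤1
... | no t≰1 = ⊥-elim (ℚ.<-irrefl refl (begin-strict
  fromℕ (suc (k ℕ.* L))          <⟨ fromℕ-mono-< linear<square ⟩
  fromℕ (c ℕ.* c)                ≡⟨ fromℕ-* c c ⟩
  fromℕ c * fromℕ c              ≤⟨ *-mono-≤-nonNeg (fromℕ-nonNeg c) (fromℕ-nonNeg c) (c≤tᵐ c) (c≤tᵐ c) ⟩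
  t ^ (n ℕ.* c) * t ^ (n ℕ.* c)  ≡⟨ sym (^-homo-* t (n ℕ.* c) (n ℕ.* c)) ⟩
  t ^ k                          ≤⟨ bound k ⟩
  fromℕ (suc (k ℕ.* L))          ∎))
  where
  open ℚ.≤-Reasoning
  -- With c = 2 + 2nL we get t ^ (2nc) ≥ c² = 2c + 2ncL, beyond the bound at k = 2nc.
  n = proj₁ (^-dominates-linear (ℚ.≰⇒> t≰1))
  c≤tᵐ = proj₂ (^-dominates-linear (ℚ.≰⇒> t≰1))
  c = 2 ℕ.+ (n ℕ.* L ℕ.+ n ℕ.* L)
  k = n ℕ.* c ℕ.+ n ℕ.* c
  linear<square : suc (k ℕ.* L) ℕ.< c ℕ.* c
  linear<square = subst₂ ℕ._<_ (ℕ.+-comm (k ℕ.* L) 1) (sym square)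
    (ℕ.+-monoʳ-< (k ℕ.* L) (ℕ.s≤s (ℕ.s≤s ℕ.z≤n)))
    where
    open ℕ-Solver
    square : c ℕ.* c ≡ k ℕ.* L ℕ.+ (c ℕ.+ c)
    square = solve 2 (λ n L → let c = con 2 :+ (n :* L :+ n :* L) in
                       c :* c := (n :* c :+ n :* c) :* L :+ (c :+ c)) refl n L

^-bounded-by-linear*^⇒≤ : ∀ {p q} L → 0ℚ ≤ q → (∀ k → p ^ k ≤ fromℕ (suc (k ℕ.* L)) * q ^ k) → p ≤ q
^-bounded-by-linear*^⇒≤ {p} {q} L 0≤q bound with ℚ.<-cmp 0ℚ q
... | tri> _ _ q<0 = ⊥-elim (ℚ.<-irrefl refl (ℚ.<-≤-trans q<0 0≤q))
... | tri≈ _ refl _ = begin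
  p                                 ≡⟨ sym (ℚ.*-identityʳ p) ⟩
  p ^ 1                             ≤⟨ bound 1 ⟩
  fromℕ (suc (1 ℕ.* L)) * (0ℚ * 1ℚ) ≡⟨ ℚ.*-zeroʳ (fromℕ (suc (1 ℕ.* L))) ⟩
  0ℚ                                ∎
  where open ℚ.≤-Reasoning
... | tri< 0<q _ _ = begin
  p           ≡⟨ p≡t*q ⟩
  t * q       ≤⟨ ℚ.*-monoʳ-≤-nonNeg q {{nonNegative 0≤q}} (^-bounded-by-linear⇒≤1 L tᵏ-bound) ⟩
  1ℚ * q      ≡⟨ ℚ.*-identityˡ q ⟩
  q           ∎
  where
  open ℚ.≤-Reasoning
  instance _ = ℚ.pos⇒nonZero q {{positive 0<q}}
  t = p * 1/ q
  p≡t*q : p ≡ t * q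
  p≡t*q = sym (trans (ℚ.*-assoc p (1/ q) q) (trans (cong (p *_) (ℚ.*-inverseˡ q)) (ℚ.*-identityʳ p)))
  tᵏ-bound : ∀ k → t ^ k ≤ fromℕ (suc (k ℕ.* L))
  tᵏ-bound k = ℚ.*-cancelʳ-≤-pos (q ^ k) {{^-pos 0<q k}} (begin
    t ^ k * q ^ k                  ≡⟨ sym (^-distrib-* t q k) ⟩
    (t * q) ^ k                    ≡⟨ cong (_^ k) (sym p≡t*q) ⟩
    p ^ k                          ≤⟨ bound k ⟩
    fromℕ (suc (k ℕ.* L)) * q ^ k  ∎)

1/-* : ∀ m n .{{_ : ℕ.NonZero m}} .{{_ : ℕ.NonZero n}} →
       (ℤ.+ 1 / (m ℕ.* n)) {{ℕ.m*n≢0 m n}} ≡ (ℤ.+ 1 / m) * (ℤ.+ 1 / n)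
1/-* (suc m) (suc n) = sym (cong₂ _*_ (ℚ.normalize-coprime (ℕ.1-coprimeTo (suc m)))
                                      (ℚ.normalize-coprime (ℕ.1-coprimeTo (suc n))))

1/-^ : ∀ r .{{_ : ℕ.NonZero r}} k → (ℤ.+ 1 / r ℕ.^ k) {{ℕ.m^n≢0 r k}} ≡ (ℤ.+ 1 / r) ^ k
1/-^ r zero    = refl
1/-^ r (suc k) = trans (1/-* r (r ℕ.^ k)) (cong ((ℤ.+ 1 / r) *_) (1/-^ r k))
  where instance _ = ℕ.m^n≢0 r k

fromℕ*1/≡1 : ∀ r .{{_ : ℕ.NonZero r}} → fromℕ r * (ℤ.+ 1 / r) ≡ 1ℚ
fromℕ*1/≡1 (suc r) = begin
  fromℕ (suc r) * (ℤ.+ 1 / suc r)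
    ≡⟨ cong₂ _*_ (fromℕ≡mkℚ (suc r)) (ℚ.normalize-coprime (ℕ.1-coprimeTo (suc r))) ⟩
  n * 1/ n
    ≡⟨ ℚ.*-inverseʳ n ⟩
  1ℚ ∎
  where
  open ≡-Reasoning
  n = mkℚ (ℤ.+ suc r) 0 (ℕ.sym (ℕ.1-coprimeTo (suc r)))

-- Finite sums and enumerations over lists

private
  variable
    X Y Z : Set

∑ : (X → ℚ) → List X → ℚ
∑ f []       = 0ℚ
∑ f (x ∷ xs) = f x + ∑ f xs

∑-++ : ∀ (f : X → ℚ) xs ys → ∑ f (xs ++ ys) ≡ ∑ f xs + ∑ f ys
∑-++ f []       ys = sym (ℚ.+-identityˡ _)
∑-++ f (x ∷ xs) ys = trans (cong (f x +_) (∑-++ f xs ys)) (sym (ℚ.+-assoc (f x) _ _))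

∑-cong : ∀ {f g : X → ℚ} xs → (∀ {x} → x ∈ xs → f x ≡ g x) → ∑ f xs ≡ ∑ g xs
∑-cong []       _     = refl
∑-cong (x ∷ xs) f≗g = cong₂ _+_ (f≗g (here refl)) (∑-cong xs (f≗g ∘ there))

∑-*ˡ : ∀ c (f : X → ℚ) xs → ∑ (λ x → c * f x) xs ≡ c * ∑ f xs
∑-*ˡ c f []       = sym (ℚ.*-zeroʳ c)
∑-*ˡ c f (x ∷ xs) = trans (cong (c * f x +_) (∑-*ˡ c f xs)) (sym (ℚ.*-distribˡ-+ c (f x) (∑ f xs)))

∑-const : ∀ c (xs : List X) → ∑ (λ _ → c) xs ≡ fromℕ (length xs) * c
∑-const c []       = sym (ℚ.*-zeroˡ c)
∑-const c (x ∷ xs) = begin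
  c + ∑ (λ _ → c) xs              ≡⟨ cong (c +_) (∑-const c xs) ⟩
  c + fromℕ (length xs) * c       ≡⟨ cong (_+ fromℕ (length xs) * c) (sym (ℚ.*-identityˡ c)) ⟩
  1ℚ * c + fromℕ (length xs) * c  ≡⟨ sym (ℚ.*-distribʳ-+ c 1ℚ (fromℕ (length xs))) ⟩
  fromℕ (length (x ∷ xs)) * c     ∎
  where open ≡-Reasoning

∑-nonNeg : ∀ {f : X → ℚ} → (∀ x → 0ℚ ≤ f x) → ∀ xs → 0ℚ ≤ ∑ f xs
∑-nonNeg f≥0 []       = ℚ.≤-refl
∑-nonNeg f≥0 (x ∷ xs) = ℚ.+-mono-≤ (f≥0 x) (∑-nonNeg f≥0 xs)

∑-mono-⊆ : ∀ {f : X → ℚ} {xs ys} → (∀ x → 0ℚ ≤ f x) → Unique xs → xs ⊆ ys → ∑ f xs ≤ ∑ f ys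
∑-mono-⊆ {xs = []}     {ys} f≥0 _            _     = ∑-nonNeg f≥0 ys
∑-mono-⊆ {f = f} {x ∷ xs} {ys} f≥0 (x∉xs ∷ uxs) xs⊆ys with ∈-∃++ (xs⊆ys (here refl))
... | ys₁ , ys₂ , refl = begin
  f x + ∑ f xs                   ≤⟨ ℚ.+-monoʳ-≤ (f x) (∑-mono-⊆ f≥0 uxs xs⊆ys₁++ys₂) ⟩
  f x + ∑ f (ys₁ ++ ys₂)         ≡⟨ cong (f x +_) (∑-++ f ys₁ ys₂) ⟩
  f x + (∑ f ys₁ + ∑ f ys₂)      ≡⟨ solve 3 (λ a b c → a :+ (b :+ c) := b :+ (a :+ c))
                                           refl (f x) (∑ f ys₁) (∑ f ys₂) ⟩
  ∑ f ys₁ + (f x + ∑ f ys₂)      ≡⟨ sym (∑-++ f ys₁ (x ∷ ys₂)) ⟩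
  ∑ f (ys₁ ++ x ∷ ys₂)           ∎
  where
  open ℚ.≤-Reasoning
  open ℚ-Solver
  xs⊆ys₁++ys₂ : xs ⊆ ys₁ ++ ys₂
  xs⊆ys₁++ys₂ {z} z∈xs with ∈-++⁻ ys₁ (xs⊆ys (there z∈xs))
  ... | inj₁ z∈ys₁         = ∈-++⁺ˡ z∈ys₁
  ... | inj₂ (here refl)   = ⊥-elim (All.lookup x∉xs z∈xs refl)
  ... | inj₂ (there z∈ys₂) = ∈-++⁺ʳ ys₁ z∈ys₂

∑-map : ∀ (f : Y → ℚ) (g : X → Y) xs → ∑ f (map g xs) ≡ ∑ (f ∘ g) xs
∑-map f g []       = refl
∑-map f g (x ∷ xs) = cong (f (g x) +_) (∑-map f g xs)

∑-cartesianProductWith : ∀ {h : Z → ℚ} {f : X → ℚ} {f′ : Y → ℚ} (g : X → Y → Z) →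
  (∀ x y → h (g x y) ≡ f x * f′ y) →
  ∀ xs ys → ∑ h (cartesianProductWith g xs ys) ≡ ∑ f xs * ∑ f′ ys
∑-cartesianProductWith {h = h} {f} {f′} g h≡f*f′ []       ys = sym (ℚ.*-zeroˡ (∑ f′ ys))
∑-cartesianProductWith {h = h} {f} {f′} g h≡f*f′ (x ∷ xs) ys = begin
  ∑ h (map (g x) ys ++ cartesianProductWith g xs ys)
    ≡⟨ ∑-++ h (map (g x) ys) _ ⟩
  ∑ h (map (g x) ys) + ∑ h (cartesianProductWith g xs ys)
    ≡⟨ cong₂ _+_ (trans (∑-map h (g x) ys) (∑-cong ys (λ {y} _ → h≡f*f′ x y)))
                 (∑-cartesianProductWith g h≡f*f′ xs ys) ⟩
  ∑ (λ y → f x * f′ y) ys + ∑ f xs * ∑ f′ ys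
    ≡⟨ cong (_+ ∑ f xs * ∑ f′ ys) (∑-*ˡ (f x) f′ ys) ⟩
  f x * ∑ f′ ys + ∑ f xs * ∑ f′ ys
    ≡⟨ sym (ℚ.*-distribʳ-+ (∑ f′ ys) (f x) (∑ f xs)) ⟩
  (f x + ∑ f xs) * ∑ f′ ys ∎
  where open ≡-Reasoning

unique-map⁺ : ∀ {g : X → Y} {xs} → (∀ {x y} → x ∈ xs → y ∈ xs → g x ≡ g y → x ≡ y) →
              Unique xs → Unique (map g xs)
unique-map⁺ {xs = []}     _   []           = []
unique-map⁺ {xs = x ∷ xs} inj (x∉xs ∷ uxs) =
  All.map⁺ (All.tabulate λ y∈xs gx≡gy → All.lookup x∉xs y∈xs (inj (here refl) (there y∈xs) gx≡gy))
  ∷ unique-map⁺ (λ x∈ y∈ → inj (there x∈) (there y∈)) uxs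

power : List X → ℕ → List (List X)
power xs zero    = [ [] ]
power xs (suc k) = cartesianProductWith _∷_ xs (power xs k)

∈-power⁻ : ∀ (xs : List X) k {s} → s ∈ power xs k → length s ≡ k × All (_∈ xs) s
∈-power⁻ xs zero    (here refl) = refl , []
∈-power⁻ xs (suc k) s∈xsᵏ⁺¹ with ∈-cartesianProductWith⁻ _∷_ xs (power xs k) s∈xsᵏ⁺¹
... | x , s , x∈xs , s∈xsᵏ , refl with ∈-power⁻ xs k s∈xsᵏ
...   | refl , s⊆xs = refl , x∈xs ∷ s⊆xs

∈-power⁺ : ∀ {xs : List X} {s} → All (_∈ xs) s → s ∈ power xs (length s)
∈-power⁺ []              = here refl
∈-power⁺ (x∈xs ∷ s⊆xs) = ∈-cartesianProductWith⁺ _∷_ x∈xs (∈-power⁺ s⊆xs)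

power-unique : ∀ {xs : List X} k → Unique xs → Unique (power xs k)
power-unique zero    _   = [] ∷ []
power-unique (suc k) uxs = Unique.cartesianProductWith⁺ _∷_ List.∷-injective uxs (power-unique k uxs)

powersFrom : List X → ℕ → ℕ → List (List X)
powersFrom xs k zero    = power xs k
powersFrom xs k (suc m) = power xs k ++ powersFrom xs (suc k) m

∈-powersFrom⁺ : ∀ {xs : List X} k m {s} → k ℕ.≤ length s → length s ℕ.≤ k ℕ.+ m → All (_∈ xs) s →
                s ∈ powersFrom xs k m
∈-powersFrom⁺ k zero {s} k≤∣s∣ ∣s∣≤k+0 s⊆xs
  rewrite ℕ.≤-antisym k≤∣s∣ (subst (length s ℕ.≤_) (ℕ.+-identityʳ k) ∣s∣≤k+0) = ∈-power⁺ s⊆xs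
∈-powersFrom⁺ k (suc m) {s} k≤∣s∣ ∣s∣≤k+1+m s⊆xs with ℕ.m≤n⇒m<n∨m≡n k≤∣s∣
... | inj₂ refl = ∈-++⁺ˡ (∈-power⁺ s⊆xs)
... | inj₁ k<∣s∣ = ∈-++⁺ʳ (power _ k)
      (∈-powersFrom⁺ (suc k) m k<∣s∣ (subst (length s ℕ.≤_) (ℕ.+-suc k m) ∣s∣≤k+1+m) s⊆xs)

sublists : List X → List (List X)
sublists []       = [ [] ]
sublists (x ∷ xs) = map (x ∷_) (sublists xs) ++ sublists xs

filter∈sublists : ∀ {P : X → Set} (P? : Decidable P) xs → filter P? xs ∈ sublists xs
filter∈sublists P? []       = here refl
filter∈sublists P? (x ∷ xs) with P? x
... | yes _ = ∈-++⁺ˡ (∈-map⁺ (x ∷_) (filter∈sublists P? xs))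
... | no  _ = ∈-++⁺ʳ (map (x ∷_) (sublists xs)) (filter∈sublists P? xs)

-- Words and codes

length≤length-concat : ∀ {D : List (List X)} → [] ∉ D → ∀ {ws} → InStar D ws →
                       length ws ℕ.≤ length (concat ws)
length≤length-concat []∉D {[]}          []         = ℕ.z≤n
length≤length-concat []∉D {[] ∷ ws}     ([]∈D ∷ _) = ⊥-elim ([]∉D []∈D)
length≤length-concat []∉D {(a ∷ w) ∷ ws} (_ ∷ ws∈D*) = ℕ.s≤s (begin
  length ws                      ≤⟨ length≤length-concat []∉D ws∈D* ⟩
  length (concat ws)             ≤⟨ ℕ.m≤n+m _ (length w) ⟩
  length w ℕ.+ length (concat ws) ≡⟨ List.length-++ w ⟨
  length (w ++ concat ws)        ∎)
  where open ℕ.≤-Reasoning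

length-concat≤ : ∀ {L} (ws : List (List X)) → All (λ w → length w ℕ.≤ L) ws →
                 length (concat ws) ℕ.≤ length ws ℕ.* L
length-concat≤ []       []             = ℕ.z≤n
length-concat≤ (w ∷ ws) (∣w∣≤L ∷ ∣ws∣≤L) = begin
  length (w ++ concat ws)          ≡⟨ List.length-++ w ⟩
  length w ℕ.+ length (concat ws)  ≤⟨ ℕ.+-mono-≤ ∣w∣≤L (length-concat≤ ws ∣ws∣≤L) ⟩
  _ ℕ.+ length ws ℕ.* _            ∎
  where open ℕ.≤-Reasoning

∈⇒length≤length-concat : ∀ {w : List X} {ws} → w ∈ ws → length w ℕ.≤ length (concat ws)
∈⇒length≤length-concat {w = w} {w ∷ ws} (here refl) =
  subst (length w ℕ.≤_) (sym (List.length-++ w)) (ℕ.m≤m+n _ _)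
∈⇒length≤length-concat {w = w} {v ∷ ws} (there w∈ws) =
  subst (length w ℕ.≤_) (sym (List.length-++ v))
        (ℕ.≤-trans (∈⇒length≤length-concat w∈ws) (ℕ.m≤n+m _ (length v)))

UD-⊆ : ∀ {D D′ : List (List X)} → D′ ⊆ D → UD D → UD D′
UD-⊆ D′⊆D udD xs ys xs∈D′* ys∈D′* = udD xs ys (All.map D′⊆D xs∈D′*) (All.map D′⊆D ys∈D′*)

maxLength : List (List X) → ℕ
maxLength C = max 0 (map length C)

length≤maxLength : ∀ {C : List (List X)} {w} → w ∈ C → length w ℕ.≤ maxLength C
length≤maxLength {C = C} w∈C = All.lookup (xs≤max 0 (map length C)) (∈-map⁺ length w∈C)

module Decomposition {A : Set} (_≟_ : DecidableEquality A) {C D : List (List A)} (C≼D : C ≼ D) where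

  open import Data.List.Membership.DecPropositional (List.≡-dec _≟_) using (_∈?_)

  decompose : List A → List (List A)
  decompose w with w ∈? C
  ... | yes w∈C = proj₁ (C≼D w w∈C)
  ... | no  _   = []

  decompose-correct : ∀ {w} → w ∈ C → InStar D (decompose w) × concat (decompose w) ≡ w
  decompose-correct {w} w∈C with w ∈? C
  ... | yes w∈C′ = proj₂ (C≼D w w∈C′)
  ... | no  w∉C  = ⊥-elim (w∉C w∈C)

  decomposeAll : List (List A) → List (List A)
  decomposeAll = concatMap decompose

  usedWords : List (List A)
  usedWords = decomposeAll C

  ∈-usedWords⁺ : ∀ {v w} → w ∈ C → v ∈ decompose w → v ∈ usedWords
  ∈-usedWords⁺ w∈C v∈decompose-w = ∈-concat⁺′ v∈decompose-w (∈-map⁺ decompose w∈C)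

  ∈-usedWords⇒length≤maxLength : ∀ {v} → v ∈ usedWords → length v ℕ.≤ maxLength C
  ∈-usedWords⇒length≤maxLength {v} v∈used with ∈-concat⁻′ (map decompose C) v∈used
  ... | ws , v∈ws , ws∈decompositions with ∈-map⁻ decompose ws∈decompositions
  ...   | w , w∈C , refl = begin
    length v                      ≤⟨ ∈⇒length≤length-concat v∈ws ⟩
    length (concat (decompose w)) ≡⟨ cong length (proj₂ (decompose-correct w∈C)) ⟩
    length w                      ≤⟨ length≤maxLength w∈C ⟩
    maxLength C                   ∎
    where open ℕ.≤-Reasoning

  decomposeAll-∈D* : ∀ {s} → InStar C s → InStar D (decomposeAll s)
  decomposeAll-∈D* []          = []
  decomposeAll-∈D* (w∈C ∷ s∈C*) = All.++⁺ (proj₁ (decompose-correct w∈C)) (decomposeAll-∈D* s∈C*)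

  concat-decomposeAll : ∀ {s} → InStar C s → concat (decomposeAll s) ≡ concat s
  concat-decomposeAll []                   = refl
  concat-decomposeAll {w ∷ s} (w∈C ∷ s∈C*) = begin
    concat (decompose w ++ decomposeAll s)
      ≡⟨ List.concat-++ (decompose w) (decomposeAll s) ⟨
    concat (decompose w) ++ concat (decomposeAll s)
      ≡⟨ cong₂ _++_ (proj₂ (decompose-correct w∈C)) (concat-decomposeAll s∈C*) ⟩
    w ++ concat s ∎
    where open ≡-Reasoning

  length≤length-decomposeAll : [] ∉ C → ∀ {s} → InStar C s → length s ℕ.≤ length (decomposeAll s)
  length≤length-decomposeAll []∉C []                   = ℕ.z≤n
  length≤length-decomposeAll []∉C {w ∷ s} (w∈C ∷ s∈C*) = begin
    suc (length s)
      ≤⟨ ℕ.+-mono-≤ 1≤∣decompose-w∣ (length≤length-decomposeAll []∉C s∈C*) ⟩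
    length (decompose w) ℕ.+ length (decomposeAll s)
      ≡⟨ List.length-++ (decompose w) ⟨
    length (decompose w ++ decomposeAll s) ∎
    where
    open ℕ.≤-Reasoning
    1≤∣decompose-w∣ : 1 ℕ.≤ length (decompose w)
    1≤∣decompose-w∣ with decompose w | decompose-correct w∈C
    ... | []    | _ , refl = ⊥-elim ([]∉C w∈C)
    ... | _ ∷ _ | _        = ℕ.s≤s ℕ.z≤n

  decomposeAll-injective : UD C → ∀ {s s′} → InStar C s → InStar C s′ →
                           decomposeAll s ≡ decomposeAll s′ → s ≡ s′
  decomposeAll-injective udC {s} {s′} s∈C* s′∈C* eq = udC s s′ s∈C* s′∈C* (begin
    concat s                   ≡⟨ concat-decomposeAll s∈C* ⟨
    concat (decomposeAll s)    ≡⟨ cong concat eq ⟩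
    concat (decomposeAll s′)   ≡⟨ concat-decomposeAll s′∈C* ⟩
    concat s′                  ∎)
    where open ≡-Reasoning

  decomposeAll-∈-powersFrom : [] ∉ C → [] ∉ D → ∀ k {s} → s ∈ power C k →
                              decomposeAll s ∈ powersFrom D k (k ℕ.* maxLength C)
  decomposeAll-∈-powersFrom []∉C []∉D k {s} s∈Cᵏ with ∈-power⁻ C k s∈Cᵏ
  ... | refl , s∈C* = ∈-powersFrom⁺ k (k ℕ.* maxLength C)
    (length≤length-decomposeAll []∉C s∈C*)
    (begin
      length (decomposeAll s)          ≤⟨ length≤length-concat []∉D (decomposeAll-∈D* s∈C*) ⟩
      length (concat (decomposeAll s)) ≡⟨ cong length (concat-decomposeAll s∈C*) ⟩
      length (concat s)                ≤⟨ length-concat≤ s (All.map length≤maxLength s∈C*) ⟩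
      k ℕ.* maxLength C                ≤⟨ ℕ.m≤n+m _ k ⟩
      k ℕ.+ k ℕ.* maxLength C          ∎)
    (decomposeAll-∈D* s∈C*)
    where open ℕ.≤-Reasoning

-- Kraft sums

module KraftSums {A : Set} (r : ℕ) .{{_ : ℕ.NonZero r}} where

  weight : List A → ℚ
  weight w = (ℤ.+ 1 / r ℕ.^ length w) {{ℕ.m^n≢0 r (length w)}}

  Kraft≡∑ : ∀ C → Kraft r C ≡ ∑ weight C
  Kraft≡∑ []      = refl
  Kraft≡∑ (w ∷ C) = cong (weight w +_) (Kraft≡∑ C)

  weight-++ : ∀ u v → weight (u ++ v) ≡ weight u * weight v
  weight-++ u v = begin
    weight (u ++ v)                       ≡⟨ 1/-^ r (length (u ++ v)) ⟩
    (ℤ.+ 1 / r) ^ length (u ++ v)         ≡⟨ cong ((ℤ.+ 1 / r) ^_) (List.length-++ u) ⟩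
    (ℤ.+ 1 / r) ^ (length u ℕ.+ length v) ≡⟨ ^-homo-* (ℤ.+ 1 / r) (length u) (length v) ⟩
    (ℤ.+ 1 / r) ^ length u * (ℤ.+ 1 / r) ^ length v
                                          ≡⟨ sym (cong₂ _*_ (1/-^ r (length u)) (1/-^ r (length v))) ⟩
    weight u * weight v                   ∎
    where open ≡-Reasoning

  weight-pos : ∀ w → 0ℚ < weight w
  weight-pos w = ℚ.positive⁻¹ _ {{ℚ.normalize-pos 1 (r ℕ.^ length w) {{ℕ.m^n≢0 r (length w)}}}}

  weight-nonNeg : ∀ w → 0ℚ ≤ weight w
  weight-nonNeg w = ℚ.<⇒≤ (weight-pos w)

  Kraft-mono-⊆ : ∀ {C D} → Unique C → C ⊆ D → Kraft r C ≤ Kraft r D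
  Kraft-mono-⊆ {C} {D} unique-C C⊆D =
    subst₂ _≤_ (sym (Kraft≡∑ C)) (sym (Kraft≡∑ D)) (∑-mono-⊆ weight-nonNeg unique-C C⊆D)

  ∑-weight-power : ∀ C k → ∑ (weight ∘ concat) (power C k) ≡ (∑ weight C) ^ k
  ∑-weight-power C zero    = ℚ.+-identityʳ 1ℚ
  ∑-weight-power C (suc k) = trans (∑-cartesianProductWith _∷_ (λ w s → weight-++ w (concat s)) C (power C k))
                                   (cong (∑ weight C *_) (∑-weight-power C k))

  ∑-weight-powersFrom : ∀ D → ∑ weight D ≤ 1ℚ → ∀ k m →
                        ∑ (weight ∘ concat) (powersFrom D k m) ≤ fromℕ (suc m) * (∑ weight D) ^ k
  ∑-weight-powersFrom D q≤1 k zero = ℚ.≤-reflexive (begin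
    ∑ (weight ∘ concat) (power D k)  ≡⟨ ∑-weight-power D k ⟩
    q ^ k                            ≡⟨ sym (ℚ.*-identityˡ (q ^ k)) ⟩
    fromℕ 1 * q ^ k                  ∎)
    where open ≡-Reasoning; q = ∑ weight D
  ∑-weight-powersFrom D q≤1 k (suc m) = begin
    ∑ (weight ∘ concat) (power D k ++ powersFrom D (suc k) m)
      ≡⟨ ∑-++ (weight ∘ concat) (power D k) _ ⟩
    ∑ (weight ∘ concat) (power D k) + ∑ (weight ∘ concat) (powersFrom D (suc k) m)
      ≤⟨ ℚ.+-mono-≤ (ℚ.≤-reflexive (∑-weight-power D k)) (∑-weight-powersFrom D q≤1 (suc k) m) ⟩
    q ^ k + fromℕ (suc m) * q ^ suc k
      ≤⟨ ℚ.+-monoʳ-≤ (q ^ k) (ℚ.*-monoˡ-≤-nonNeg (fromℕ (suc m)) {{nonNegative (fromℕ-nonNeg (suc m))}}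
                                                  (^-suc-≤ (∑-nonNeg weight-nonNeg D) q≤1 k)) ⟩
    q ^ k + fromℕ (suc m) * q ^ k
      ≡⟨ cong (_+ fromℕ (suc m) * q ^ k) (sym (ℚ.*-identityˡ (q ^ k))) ⟩
    1ℚ * q ^ k + fromℕ (suc m) * q ^ k
      ≡⟨ sym (ℚ.*-distribʳ-+ (q ^ k) 1ℚ (fromℕ (suc m))) ⟩
    fromℕ (suc (suc m)) * q ^ k ∎
    where open ℚ.≤-Reasoning; q = ∑ weight D

module Refinements {A : Set} (_≟_ : DecidableEquality A) (r : ℕ) .{{_ : ℕ.NonZero r}} where

  open KraftSums {A} r
  open import Data.List.Membership.DecPropositional (List.≡-dec _≟_) using (_∈?_)

  Kraft-mono-≤1 : ∀ {C D} → IsCode C → UD C → [] ∉ D → C ≼ D → Kraft r D ≤ 1ℚ → Kraft r C ≤ Kraft r D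
  Kraft-mono-≤1 {C} {D} ([]∉C , unique-C) udC []∉D C≼D KD≤1 =
    subst₂ _≤_ (sym (Kraft≡∑ C)) (sym (Kraft≡∑ D))
      (^-bounded-by-linear*^⇒≤ L (∑-nonNeg weight-nonNeg D) bound)
    where
    open Decomposition _≟_ C≼D
    L = maxLength C
    decomposeAll-injectiveOn : ∀ k {s s′} → s ∈ power C k → s′ ∈ power C k →
                               decomposeAll s ≡ decomposeAll s′ → s ≡ s′
    decomposeAll-injectiveOn k s∈Cᵏ s′∈Cᵏ =
      decomposeAll-injective udC (proj₂ (∈-power⁻ C k s∈Cᵏ)) (proj₂ (∈-power⁻ C k s′∈Cᵏ))
    image⊆powersFrom : ∀ k → map decomposeAll (power C k) ⊆ powersFrom D k (k ℕ.* L)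
    image⊆powersFrom k u∈image with ∈-map⁻ decomposeAll u∈image
    ... | s , s∈Cᵏ , refl = decomposeAll-∈-powersFrom []∉C []∉D k s∈Cᵏ
    bound : ∀ k → (∑ weight C) ^ k ≤ fromℕ (suc (k ℕ.* L)) * (∑ weight D) ^ k
    bound k = begin
      (∑ weight C) ^ k
        ≡⟨ ∑-weight-power C k ⟨
      ∑ (weight ∘ concat) (power C k)
        ≡⟨ ∑-cong (power C k) (λ s∈Cᵏ → cong weight (concat-decomposeAll (proj₂ (∈-power⁻ C k s∈Cᵏ)))) ⟨
      ∑ (weight ∘ concat ∘ decomposeAll) (power C k)
        ≡⟨ ∑-map (weight ∘ concat) decomposeAll (power C k) ⟨
      ∑ (weight ∘ concat) (map decomposeAll (power C k))
        ≤⟨ ∑-mono-⊆ (weight-nonNeg ∘ concat) (unique-map⁺ (decomposeAll-injectiveOn k) (power-unique k unique-C))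
                    (image⊆powersFrom k) ⟩
      ∑ (weight ∘ concat) (powersFrom D k (k ℕ.* L))
        ≤⟨ ∑-weight-powersFrom D (subst (_≤ 1ℚ) (Kraft≡∑ D) KD≤1) k (k ℕ.* L) ⟩
      fromℕ (suc (k ℕ.* L)) * (∑ weight D) ^ k ∎
      where open ℚ.≤-Reasoning

  module _ (letters : List A) (letters-complete : ∀ a → a ∈ letters) (length-letters : length letters ≡ r) where

    singletons : List (List A)
    singletons = map [_] letters

    Kraft-singletons : Kraft r singletons ≡ 1ℚ
    Kraft-singletons = begin
      Kraft r singletons                       ≡⟨ Kraft≡∑ singletons ⟩
      ∑ weight (map [_] letters)               ≡⟨ ∑-map weight [_] letters ⟩
      ∑ (λ _ → 1/r¹) letters                   ≡⟨ ∑-const 1/r¹ letters ⟩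
      fromℕ (length letters) * 1/r¹
        ≡⟨ cong₂ (λ n q → fromℕ n * q) length-letters (trans (1/-^ r 1) (ℚ.*-identityʳ _)) ⟩
      fromℕ r * (ℤ.+ 1 / r)                    ≡⟨ fromℕ*1/≡1 r ⟩
      1ℚ                                       ∎
      where
      open ≡-Reasoning
      1/r¹ = (ℤ.+ 1 / r ℕ.^ 1) {{ℕ.m^n≢0 r 1}}

    []∉singletons : [] ∉ singletons
    []∉singletons []∈singletons with ∈-map⁻ [_] []∈singletons
    ... | _ , _ , ()

    ≼-singletons : ∀ C → C ≼ singletons
    ≼-singletons C w _ =
      map [_] w , All.map⁺ (All.tabulate λ {a} _ → ∈-map⁺ [_] (letters-complete a)) , List.concat-map-[ w ]

    McMillan : ∀ {D} → IsCode D → UD D → Kraft r D ≤ 1ℚ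
    McMillan {D} code-D udD = subst (Kraft r D ≤_) Kraft-singletons
      (Kraft-mono-≤1 code-D udD []∉singletons (≼-singletons D) (ℚ.≤-reflexive Kraft-singletons))

    Kraft-mono : ∀ C D → IsCode C → IsCode D → UD C → UD D → C ≼ D → Kraft r C ≤ Kraft r D
    Kraft-mono C D code-C code-D udC udD C≼D = Kraft-mono-≤1 code-C udC (proj₁ code-D) C≼D (McMillan code-D udD)

    tight-refinement-uses-every-word : ∀ {C D} → IsCode C → UD C → IsCode D → UD D → (C≼D : C ≼ D) →
      Kraft r D ≡ Kraft r C → D ⊆ Decomposition.usedWords _≟_ C≼D
    tight-refinement-uses-every-word {C} {D} code-C udC ([]∉D , unique-D) udD C≼D KD≡KC {d} d∈D
      with d ∈? Decomposition.usedWords _≟_ C≼D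
    ... | yes d∈used = d∈used
    ... | no  d∉used = ⊥-elim (ℚ.<-irrefl refl (begin-strict
      Kraft r D             ≡⟨ KD≡KC ⟩
      Kraft r C             ≤⟨ Kraft-mono C D′ code-C code-D′ udC (UD-⊆ D′⊆D udD) C≼D′ ⟩
      Kraft r D′            <⟨ subst (_< weight d + Kraft r D′) (ℚ.+-identityˡ _)
                                     (ℚ.+-monoˡ-< (Kraft r D′) (weight-pos d)) ⟩
      Kraft r (d ∷ D′)      ≤⟨ Kraft-mono-⊆ unique-d∷D′ d∷D′⊆D ⟩
      Kraft r D             ∎))
      where
      open ℚ.≤-Reasoning
      open Decomposition _≟_ C≼D
      D′ = filter (_∈? usedWords) D
      D′⊆D : D′ ⊆ D
      D′⊆D = proj₁ ∘ ∈-filter⁻ (_∈? usedWords)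
      D′⊆usedWords : D′ ⊆ usedWords
      D′⊆usedWords = proj₂ ∘ ∈-filter⁻ (_∈? usedWords) {xs = D}
      code-D′ : IsCode D′
      code-D′ = []∉D ∘ D′⊆D , Unique.filter⁺ (_∈? usedWords) {D} unique-D
      C≼D′ : C ≼ D′
      C≼D′ w w∈C = decompose w ,
        All.tabulate (λ v∈ → ∈-filter⁺ (_∈? usedWords) (All.lookup (proj₁ (decompose-correct w∈C)) v∈)
                                                      (∈-usedWords⁺ w∈C v∈)) ,
        proj₂ (decompose-correct w∈C)
      d∷D′⊆D : d ∷ D′ ⊆ D
      d∷D′⊆D (here refl)  = d∈D
      d∷D′⊆D (there v∈D′) = D′⊆D v∈D′
      unique-d∷D′ : Unique (d ∷ D′)
      unique-d∷D′ =
        All.tabulate (λ v∈D′ d≡v → d∉used (subst (_∈ usedWords) (sym d≡v) (D′⊆usedWords v∈D′)))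
        ∷ Unique.filter⁺ (_∈? usedWords) {D} unique-D

    shortWords : ℕ → List (List A)
    shortWords L = powersFrom letters 0 L

    tight-refinement-⊆-shortWords : ∀ {C D} → IsCode C → UD C → IsCode D → UD D → C ≼ D →
      Kraft r D ≡ Kraft r C → D ⊆ shortWords (maxLength C)
    tight-refinement-⊆-shortWords code-C udC code-D udD C≼D KD≡KC d∈D =
      ∈-powersFrom⁺ 0 _ ℕ.z≤n
        (Decomposition.∈-usedWords⇒length≤maxLength _≟_ C≼D
          (tight-refinement-uses-every-word code-C udC code-D udD C≼D KD≡KC d∈D))
        (All.tabulate λ {a} _ → letters-complete a)

    finitely-many-tight-refinements : ∀ C → IsCode C → UD C →
      Σ (List (List (List A))) λ Ds → ∀ D → IsCode D → UD D → C ≼ D → Kraft r D ≡ Kraft r C →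
        Σ (List (List A)) λ E → E ∈ Ds × SameSet D E
    finitely-many-tight-refinements C code-C udC = sublists W , λ D code-D udD C≼D KD≡KC →
      let D⊆W = tight-refinement-⊆-shortWords code-C udC code-D udD C≼D KD≡KC in
      filter (_∈? D) W , filter∈sublists (_∈? D) W ,
      λ w → (λ w∈D → ∈-filter⁺ (_∈? D) (D⊆W w∈D) w∈D) , proj₂ ∘ ∈-filter⁻ (_∈? D) {xs = W}
      where W = shortWords (maxLength C)

module Enumeration {A : Set} {r : ℕ} (Fin↔A : Fin r ↔ A) where

  open Inverse Fin↔A

  letters : List A
  letters = map to (allFin r)

  letters-complete : ∀ a → a ∈ letters
  letters-complete a = subst (_∈ letters) (strictlyInverseˡ a) (∈-map⁺ to (∈-allFin (from a)))

  length-letters : length letters ≡ r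
  length-letters = trans (List.length-map to (allFin r)) (List.length-tabulate (λ i → i))

  _≟_ : DecidableEquality A
  _≟_ = Fin.inj⇒≟ (↔⇒↣ (↔-sym Fin↔A))

proposition2 : (A : Set) (r : ℕ) .{{_ : NonZero r}} → (Fin r ↔ A) →
    ((C D : List (List A)) → IsCode C → IsCode D → UD C → UD D → C ≼ D →
      Kraft r C ≤ Kraft r D)
    × ((C : List (List A)) → IsCode C → UD C →
      Σ (List (List (List A))) λ Ds → (D : List (List A)) → IsCode D → UD D → C ≼ D →
        Kraft r D ≡ Kraft r C → Σ (List (List A)) λ E → (E ∈ Ds) × SameSet D E)
proposition2 A r Fin↔A =
    Kraft-mono letters letters-complete length-letters
  , finitely-many-tight-refinements letters letters-complete length-letters
  where
  open Enumeration Fin↔A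
  open Refinements _≟_ r
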